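{- Let $L=\{(p_1,q_1),\ldots,(p_n,q_n)\}$ be a lattice diagram with $n$ cells, listed in increasing pseudo-lexicographic order, and let $k\ge 1$ be an integer. Then $$e_k\Big(\tfrac{\partial}{\partial x_1},\ldots,\tfrac{\partial}{\partial x_n}\Big)\Delta_L(X;Y)=\sum_{1\le i_1<i_2<\cdots<i_k\le n}\epsilon(e_k(i_1,\ldots,i_k;L))\,\Delta_{e_k(i_1,\ldots,i_k;L)}(X;Y),$$ where $e_k(i_1,\ldots,i_k;L)$ is the list obtained from $L$ by replacing the biexponents $(p_{i_1},q_{i_1}),\ldots,(p_{i_k},q_{i_k})$ by $(p_{i_1}-1,q_{i_1}),\ldots,(p_{i_k}-1,q_{i_k})$ (all other biexponents unchanged), and each coefficient $\epsilon(e_k(i_1,\ldots,i_k;L))$ is a nonnegative integer which is different from zero only when the resulting list consists of $n$ distinct cells of $\mathbb{N}\times\mathbb{N}$.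
   Context: A lattice diagram is a finite subset of $\mathbb{N}\times\mathbb{N}$. The pseudo-lexicographic order on cells is: $(p,q)<(p',q')$ iff $q<q'$, or $q=q'$ and $p<p'$ (e.g. $(0,0),(1,0),(2,0),(0,1),(1,1),(0,2),(0,3)$ is increasing). For a lattice diagram $D=\{(p_1,q_1),\ldots,(p_n,q_n)\}$ listed in increasing pseudo-lexicographic order, with $X=\{x_1,\ldots,x_n\}$, $Y=\{y_1,\ldots,y_n\}$, the lattice determinant is $\Delta_D(X;Y)=\det\|x_i^{p_j}y_i^{q_j}\|_{i,j=1}^n$. $e_k$ denotes the $k$-th elementary symmetric polynomial, applied to the partial derivative operators in the $x$ variables. Terms whose coefficient is zero are understood to contribute nothing. -}

module Defs where

open import Data.Nat as ℕ using (ℕ; zero; suc; _∸_)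
open import Data.Integer as ℤ using (ℤ; +_)
open import Data.Fin as Fin using (Fin; zero; suc; punchIn)
open import Data.Vec as Vec using (Vec; lookup; replicate; updateAt; zipWith)
open import Data.Vec.Properties as VecP using ()
open import Data.List as List using (List; []; _∷_; _++_; map; concatMap; filter; allFin; foldr)
open import Data.Bool using (Bool; true; false; if_then_else_)
open import Data.Product using (_×_; _,_; proj₁; proj₂)
open import Data.Product.Properties as ProdP using ()
open import Data.Sum using (_⊎_)
open import Data.Fin.Subset using (Subset; ∣_∣; _∈_)
open import Relation.Binary.PropositionalEquality using (_≡_)
open import Relation.Nullary using (does)

-- A monomial x^a y^b is given by its two exponent vectors (a , b).
Mono : ℕ → Set
Mono n = Vec ℕ n × Vec ℕ n

_≟M_ : ∀ {n} (m m' : Mono n) → Relation.Nullary.Dec (m ≡ m')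
_≟M_ = ProdP.≡-dec (VecP.≡-dec ℕ._≟_) (VecP.≡-dec ℕ._≟_)

-- A polynomial is a finite formal sum of terms (coefficient , monomial).
Poly : ℕ → Set
Poly n = List (ℤ × Mono n)

coeff : ∀ {n} → Poly n → Mono n → ℤ
coeff [] m = + 0
coeff ((c , m') ∷ ps) m = (if does (m' ≟M m) then c else + 0) ℤ.+ coeff ps m

infix 4 _≈P_
_≈P_ : ∀ {n} → Poly n → Poly n → Set
p ≈P q = ∀ m → coeff p m ≡ coeff q m

0P : ∀ {n} → Poly n
0P = []

1P : ∀ {n} → Poly n
1P {n} = (+ 1 , (replicate n 0 , replicate n 0)) ∷ []

infixl 6 _+P_
_+P_ : ∀ {n} → Poly n → Poly n → Poly n
p +P q = p ++ q

-P_ : ∀ {n} → Poly n → Poly n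
-P p = map (λ t → (ℤ.- proj₁ t , proj₂ t)) p

scaleP : ∀ {n} → ℤ → Poly n → Poly n
scaleP c p = map (λ t → (c ℤ.* proj₁ t , proj₂ t)) p

infixl 7 _*P_
_*P_ : ∀ {n} → Poly n → Poly n → Poly n
p *P q = concatMap (λ t → map (λ u → (proj₁ t ℤ.* proj₁ u ,
           (zipWith ℕ._+_ (proj₁ (proj₂ t)) (proj₁ (proj₂ u)) ,
            zipWith ℕ._+_ (proj₂ (proj₂ t)) (proj₂ (proj₂ u))))) q) p

sumP : ∀ {n} → List (Poly n) → Poly n
sumP = foldr _+P_ 0P

∂x : ∀ {n} → Fin n → Poly n → Poly n
∂x i p = map (λ t → (proj₁ t ℤ.* + lookup (proj₁ (proj₂ t)) i ,
                    (updateAt (proj₁ (proj₂ t)) i (_∸ 1) , proj₂ (proj₂ t)))) p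

negPow : ∀ {n} → ℕ → Poly n → Poly n
negPow zero p = p
negPow (suc k) p = -P (negPow k p)

det : ∀ {n} (m : ℕ) → (Fin m → Fin m → Poly n) → Poly n
det zero M = 1P
det (suc m) M =
  sumP (map (λ j → negPow (Fin.toℕ j)
                     (M zero j *P det m (λ r c → M (suc r) (punchIn j c))))
            (allFin (suc m)))

Cell : Set
Cell = ℕ × ℕ

_<pl_ : Cell → Cell → Set
(p , q) <pl (p' , q') = (q ℕ.< q') ⊎ ((q ≡ q') × (p ℕ.< p'))

-- a list of n cells (p₁,q₁),…,(pₙ,qₙ) given as a function Fin n → Cell
StrictlyIncreasing : ∀ {n} → (Fin n → Cell) → Set
StrictlyIncreasing L = ∀ i j → i Fin.< j → L i <pl L j

monoXY : ∀ {n} → Fin n → ℕ → ℕ → Poly n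
monoXY {n} i p q =
  (+ 1 , (updateAt (replicate n 0) i (λ _ → p) , updateAt (replicate n 0) i (λ _ → q))) ∷ []

Δ : ∀ {n} → (Fin n → Cell) → Poly n
Δ {n} D = det n (λ i j → monoXY i (proj₁ (D j)) (proj₂ (D j)))

allSubsets : (n : ℕ) → List (Subset n)
allSubsets zero = Vec.[] ∷ []
allSubsets (suc n) = map (true Vec.∷_) (allSubsets n) ++ map (false Vec.∷_) (allSubsets n)

kSubsets : (n k : ℕ) → List (Subset n)
kSubsets n k = filter (λ S → ∣ S ∣ ℕ.≟ k) (allSubsets n)

applyDerivs : ∀ {n} → Subset n → Poly n → Poly n
applyDerivs {n} S p = foldr (λ i r → if lookup S i then ∂x i r else r) p (allFin n)

eOp : ∀ {n} → ℕ → Poly n → Poly n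
eOp {n} k p = sumP (map (λ S → applyDerivs S p) (kSubsets n k))

-- e_k(i₁,…,i_k; L): replace (p_{i},q_{i}) by (p_{i}-1,q_{i}) for i ∈ S
-- (truncated subtraction; only used when the coefficient may be nonzero,
--  in which case all these p_i ≥ 1)
lowerCells : ∀ {n} → Subset n → (Fin n → Cell) → (Fin n → Cell)
lowerCells S L j = if lookup S j then (proj₁ (L j) ∸ 1 , proj₂ (L j)) else L j

ValidLowering : ∀ {n} → Subset n → (Fin n → Cell) → Set
ValidLowering S L =
  (∀ j → j ∈ S → 1 ℕ.≤ proj₁ (L j)) ×
  (∀ i j → lowerCells S L i ≡ lowerCells S L j → i ≡ j)

module Submission where

-- Induct on the size m of a lattice determinant in m of the variables x₁, …, xₘ, using
-- eₖ₊₁(∂₁, ∂⃗) = eₖ₊₁(∂⃗) + ∂₁ eₖ(∂⃗) and expanding the determinant along its first row, the row of x₁.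
-- The operators in ∂⃗ do not see x₁, so they pass through the first-row monomials onto the minors,
-- where induction applies; ∂₁ turns x₁^{p_j} into p_j x₁^{p_j - 1}, lowering the cell of column j.
-- Regrouping the subsets T by whether they contain j gives the same expansion for
-- Σ_T (∏_{j ∈ T} p_j) Δ_{L lowered at T}, all identities being checked coefficientwise. Finally a term
-- whose lowered diagram has a repeated cell vanishes: either some p_j = 0 kills its weight, or, the
-- diagram being increasing, the repeated cells sit in adjacent columns and the determinant alternates.

open import Defs
open import Data.Nat as ℕ using (ℕ; zero; suc; _∸_; _≤_)
import Data.Nat.Properties as ℕP
open import Data.Integer using (ℤ; +_) renaming (_+_ to _+ℤ_; _*_ to _*ℤ_; -_ to -ℤ_)
import Data.Integer.Properties as ℤP
open import Data.Integer.Tactic.RingSolver using (solve-∀)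
open import Data.Fin as Fin using (Fin; zero; suc; punchIn; toℕ; inject₁)
import Data.Fin.Properties as FinP
open import Data.Fin.Subset using (Subset; ∣_∣)
open import Data.Vec using (Vec; []; _∷_; lookup; replicate; updateAt; zipWith; insertAt)
import Data.Vec.Properties as VecP
open import Data.List as List using (List; []; _∷_; _++_; map; foldr; allFin)
import Data.List.Properties as ListP
open import Data.List.Relation.Unary.All as All using (All; []; _∷_)
import Data.List.Relation.Unary.All.Properties as AllP
open import Data.Bool using (Bool; true; false; if_then_else_)
open import Data.Product using (_×_; _,_; proj₁; proj₂; ∃)
import Data.Product.Properties as ProdP
open import Data.Sum using (inj₁; inj₂)
open import Data.Empty using (⊥; ⊥-elim)
open import Function using (_∘_; id)
open import Function.Definitions using (Injective)
open import Algebra.Properties.CommutativeSemigroup ℕP.*-commutativeSemigroup using (x∙yz≈y∙xz)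
import Algebra.Properties.CommutativeSemigroup ℤP.*-commutativeSemigroup as ℤ*
open import Relation.Binary.Bundles using (Setoid)
open import Relation.Binary.Definitions using (tri<; tri≈; tri>)
open import Relation.Binary.PropositionalEquality
import Relation.Binary.Reasoning.Setoid as SetoidReasoning
open import Relation.Nullary using (does; yes; no; Dec; ¬_)
open import Relation.Nullary.Decidable using (dec-true; dec-false; ¬?; _×-dec_; decidable-stable)

private variable A B : Set

∑ : List A → (A → ℤ) → ℤ
∑ [] f = + 0
∑ (x ∷ xs) f = f x +ℤ ∑ xs f

∑-cong : {f g : A → ℤ} (xs : List A) → (∀ x → f x ≡ g x) → ∑ xs f ≡ ∑ xs g
∑-cong [] e = refl
∑-cong (x ∷ xs) e = cong₂ _+ℤ_ (e x) (∑-cong xs e)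

∑-++ : (xs ys : List A) (f : A → ℤ) → ∑ (xs ++ ys) f ≡ ∑ xs f +ℤ ∑ ys f
∑-++ [] ys f = sym (ℤP.+-identityˡ _)
∑-++ (x ∷ xs) ys f = trans (cong (f x +ℤ_) (∑-++ xs ys f)) (sym (ℤP.+-assoc (f x) _ _))

∑-map : (g : B → A) (xs : List B) (f : A → ℤ) → ∑ (map g xs) f ≡ ∑ xs (f ∘ g)
∑-map g [] f = refl
∑-map g (x ∷ xs) f = cong (f (g x) +ℤ_) (∑-map g xs f)

∑-zero : (xs : List A) → ∑ xs (λ _ → + 0) ≡ + 0
∑-zero [] = refl
∑-zero (x ∷ xs) = trans (ℤP.+-identityˡ _) (∑-zero xs)

∑-distrib-+ : (xs : List A) (f g : A → ℤ) → ∑ xs (λ x → f x +ℤ g x) ≡ ∑ xs f +ℤ ∑ xs g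
∑-distrib-+ [] f g = refl
∑-distrib-+ (x ∷ xs) f g = begin
  f x +ℤ g x +ℤ ∑ xs (λ x → f x +ℤ g x) ≡⟨ cong (f x +ℤ g x +ℤ_) (∑-distrib-+ xs f g) ⟩
  f x +ℤ g x +ℤ (∑ xs f +ℤ ∑ xs g)      ≡⟨ swap (f x) (g x) (∑ xs f) (∑ xs g) ⟩
  f x +ℤ ∑ xs f +ℤ (g x +ℤ ∑ xs g)      ∎
  where
  open ≡-Reasoning
  swap : ∀ a b c d → a +ℤ b +ℤ (c +ℤ d) ≡ a +ℤ c +ℤ (b +ℤ d)
  swap = solve-∀

∑-*ˡ : (c : ℤ) (xs : List A) (f : A → ℤ) → ∑ xs (λ x → c *ℤ f x) ≡ c *ℤ ∑ xs f
∑-*ˡ c [] f = sym (ℤP.*-zeroʳ c)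
∑-*ˡ c (x ∷ xs) f = trans (cong (c *ℤ f x +ℤ_) (∑-*ˡ c xs f)) (sym (ℤP.*-distribˡ-+ c (f x) _))

∑-comm : (xs : List A) (ys : List B) (f : A → B → ℤ) →
         ∑ xs (λ x → ∑ ys (f x)) ≡ ∑ ys (λ y → ∑ xs (λ x → f x y))
∑-comm [] ys f = sym (∑-zero ys)
∑-comm (x ∷ xs) ys f =
  trans (cong (∑ ys (f x) +ℤ_) (∑-comm xs ys f)) (sym (∑-distrib-+ ys (f x) _))

∑-allFin-suc : (N : ℕ) (f : Fin (suc N) → ℤ) →
               ∑ (allFin (suc N)) f ≡ f zero +ℤ ∑ (allFin N) (f ∘ suc)
∑-allFin-suc N f = cong (f zero +ℤ_)
  (trans (cong (λ xs → ∑ xs f) (sym (ListP.map-tabulate id suc))) (∑-map suc (allFin N) f))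

indicator : ∀ {N} → Fin N → ℤ → Fin N → ℤ
indicator a x j = if does (j Fin.≟ a) then x else + 0

∑-allFin-indicator : (N : ℕ) (a : Fin N) (x : ℤ) → ∑ (allFin N) (indicator a x) ≡ x
∑-allFin-indicator (suc N) zero x = begin
  ∑ (allFin (suc N)) (indicator zero x)       ≡⟨ ∑-allFin-suc N (indicator zero x) ⟩
  x +ℤ ∑ (allFin N) (indicator zero x ∘ suc)  ≡⟨ cong (x +ℤ_) (∑-zero (allFin N)) ⟩
  x +ℤ + 0                                    ≡⟨ ℤP.+-identityʳ x ⟩
  x                                           ∎
  where open ≡-Reasoning
∑-allFin-indicator (suc N) (suc a) x = begin
  ∑ (allFin (suc N)) (indicator (suc a) x)         ≡⟨ ∑-allFin-suc N (indicator (suc a) x) ⟩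
  + 0 +ℤ ∑ (allFin N) (indicator (suc a) x ∘ suc)  ≡⟨ ℤP.+-identityˡ _ ⟩
  ∑ (allFin N) (indicator a x)                     ≡⟨ ∑-allFin-indicator N a x ⟩
  x                                                ∎
  where open ≡-Reasoning

∑-allFin-two : (N : ℕ) (f : Fin N → ℤ) (a b : Fin N) → a ≢ b →
               (∀ j → j ≢ a → j ≢ b → f j ≡ + 0) → ∑ (allFin N) f ≡ f a +ℤ f b
∑-allFin-two N f a b a≢b rest = begin
  ∑ (allFin N) f                                                   ≡⟨ ∑-cong (allFin N) split ⟩
  ∑ (allFin N) (λ j → indicator a (f a) j +ℤ indicator b (f b) j)  ≡⟨ ∑-distrib-+ (allFin N) _ _ ⟩
  ∑ (allFin N) (indicator a (f a)) +ℤ ∑ (allFin N) (indicator b (f b))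
    ≡⟨ cong₂ _+ℤ_ (∑-allFin-indicator N a (f a)) (∑-allFin-indicator N b (f b)) ⟩
  f a +ℤ f b                                                       ∎
  where
  open ≡-Reasoning
  split : ∀ j → f j ≡ indicator a (f a) j +ℤ indicator b (f b) j
  split j with j Fin.≟ a | j Fin.≟ b
  ... | yes refl | yes refl = ⊥-elim (a≢b refl)
  ... | yes refl | no _     = sym (ℤP.+-identityʳ (f j))
  ... | no _     | yes refl = sym (ℤP.+-identityˡ (f j))
  ... | no j≢a   | no j≢b   = rest j j≢a j≢b

sign : ℕ → ℤ
sign zero = + 1
sign (suc k) = -ℤ sign k

module _ {n : ℕ} where

  infix 4 _≋_
  record _≋_ (p q : Poly n) : Set where
    constructor coeffwise
    field coeff-≡ : p ≈P q
  open _≋_ public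

  ≋-setoid : Setoid _ _
  ≋-setoid = record
    { Carrier = Poly n
    ; _≈_ = _≋_
    ; isEquivalence = record
      { refl = coeffwise λ _ → refl
      ; sym = λ e → coeffwise λ mo → sym (coeff-≡ e mo)
      ; trans = λ e f → coeffwise λ mo → trans (coeff-≡ e mo) (coeff-≡ f mo) } }

  open Setoid ≋-setoid public using () renaming (refl to ≋-refl; sym to ≋-sym; trans to ≋-trans)

  module ≋-Reasoning = SetoidReasoning ≋-setoid

  ≡⇒≋ : {p q : Poly n} → p ≡ q → p ≋ q
  ≡⇒≋ refl = ≋-refl

  coeff-++ : (p q : Poly n) (mo : Mono n) → coeff (p ++ q) mo ≡ coeff p mo +ℤ coeff q mo
  coeff-++ [] q mo = sym (ℤP.+-identityˡ _)
  coeff-++ ((c , m) ∷ p) q mo =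
    trans (cong (h +ℤ_) (coeff-++ p q mo)) (sym (ℤP.+-assoc h (coeff p mo) (coeff q mo)))
    where h = if does (m ≟M mo) then c else + 0

  coeff-neg : (p : Poly n) (mo : Mono n) → coeff (-P p) mo ≡ -ℤ coeff p mo
  coeff-neg [] mo = refl
  coeff-neg ((c , m) ∷ p) mo with does (m ≟M mo)
  ... | true  = trans (cong (-ℤ c +ℤ_) (coeff-neg p mo)) (sym (ℤP.neg-distrib-+ c (coeff p mo)))
  ... | false = trans (cong (+ 0 +ℤ_) (coeff-neg p mo)) (sym (ℤP.neg-distrib-+ (+ 0) (coeff p mo)))

  coeff-scaleP : (c : ℤ) (p : Poly n) (mo : Mono n) → coeff (scaleP c p) mo ≡ c *ℤ coeff p mo
  coeff-scaleP c [] mo = sym (ℤP.*-zeroʳ c)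
  coeff-scaleP c ((d , m) ∷ p) mo with does (m ≟M mo)
  ... | true  = trans (cong (c *ℤ d +ℤ_) (coeff-scaleP c p mo)) (sym (ℤP.*-distribˡ-+ c d (coeff p mo)))
  ... | false = trans (cong₂ _+ℤ_ (sym (ℤP.*-zeroʳ c)) (coeff-scaleP c p mo))
                      (sym (ℤP.*-distribˡ-+ c (+ 0) (coeff p mo)))

  coeff-negPow : (k : ℕ) (p : Poly n) (mo : Mono n) → coeff (negPow k p) mo ≡ sign k *ℤ coeff p mo
  coeff-negPow zero p mo = sym (ℤP.*-identityˡ _)
  coeff-negPow (suc k) p mo = trans (coeff-neg (negPow k p) mo)
    (trans (cong -ℤ_ (coeff-negPow k p mo)) (ℤP.neg-distribˡ-* (sign k) _))

  coeff-sumP : (f : A → Poly n) (xs : List A) (mo : Mono n) →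
               coeff (sumP (map f xs)) mo ≡ ∑ xs (λ x → coeff (f x) mo)
  coeff-sumP f [] mo = refl
  coeff-sumP f (x ∷ xs) mo =
    trans (coeff-++ (f x) _ mo) (cong (coeff (f x) mo +ℤ_) (coeff-sumP f xs mo))

  +P-cong : {p p′ q q′ : Poly n} → p ≋ p′ → q ≋ q′ → p +P q ≋ p′ +P q′
  +P-cong {p} {p′} {q} {q′} e f = coeffwise λ mo → begin
    coeff (p +P q) mo          ≡⟨ coeff-++ p q mo ⟩
    coeff p mo +ℤ coeff q mo   ≡⟨ cong₂ _+ℤ_ (coeff-≡ e mo) (coeff-≡ f mo) ⟩
    coeff p′ mo +ℤ coeff q′ mo ≡⟨ coeff-++ p′ q′ mo ⟨
    coeff (p′ +P q′) mo        ∎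
    where open ≡-Reasoning

  +P-comm : (p q : Poly n) → p +P q ≋ q +P p
  +P-comm p q = coeffwise λ mo →
    trans (coeff-++ p q mo) (trans (ℤP.+-comm (coeff p mo) (coeff q mo)) (sym (coeff-++ q p mo)))

  +P-interchange : (p q r s : Poly n) → (p +P q) +P (r +P s) ≋ (p +P r) +P (q +P s)
  +P-interchange p q r s = coeffwise λ mo → begin
    coeff ((p ++ q) ++ (r ++ s)) mo
      ≡⟨ trans (coeff-++ (p ++ q) (r ++ s) mo) (cong₂ _+ℤ_ (coeff-++ p q mo) (coeff-++ r s mo)) ⟩
    coeff p mo +ℤ coeff q mo +ℤ (coeff r mo +ℤ coeff s mo)
      ≡⟨ swap (coeff p mo) (coeff q mo) (coeff r mo) (coeff s mo) ⟩
    coeff p mo +ℤ coeff r mo +ℤ (coeff q mo +ℤ coeff s mo)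
      ≡⟨ trans (coeff-++ (p ++ r) (q ++ s) mo) (cong₂ _+ℤ_ (coeff-++ p r mo) (coeff-++ q s mo)) ⟨
    coeff ((p ++ r) ++ (q ++ s)) mo ∎
    where
    open ≡-Reasoning
    swap : ∀ a b c d → a +ℤ b +ℤ (c +ℤ d) ≡ a +ℤ c +ℤ (b +ℤ d)
    swap = solve-∀

  -P-cong : {p q : Poly n} → p ≋ q → -P p ≋ -P q
  -P-cong {p} {q} e = coeffwise λ mo →
    trans (coeff-neg p mo) (trans (cong -ℤ_ (coeff-≡ e mo)) (sym (coeff-neg q mo)))

  scaleP-cong : (c : ℤ) {p q : Poly n} → p ≋ q → scaleP c p ≋ scaleP c q
  scaleP-cong c {p} {q} e = coeffwise λ mo →
    trans (coeff-scaleP c p mo) (trans (cong (c *ℤ_) (coeff-≡ e mo)) (sym (coeff-scaleP c q mo)))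

  scaleP-zero : (p : Poly n) → scaleP (+ 0) p ≋ 0P
  scaleP-zero p = coeffwise λ mo → trans (coeff-scaleP (+ 0) p mo) (ℤP.*-zeroˡ (coeff p mo))

  negPow-cong : (k : ℕ) {p q : Poly n} → p ≋ q → negPow k p ≋ negPow k q
  negPow-cong k {p} {q} e = coeffwise λ mo →
    trans (coeff-negPow k p mo) (trans (cong (sign k *ℤ_) (coeff-≡ e mo)) (sym (coeff-negPow k q mo)))

  negPow-+P : (k : ℕ) (p q : Poly n) → negPow k (p +P q) ≡ negPow k p +P negPow k q
  negPow-+P zero p q = refl
  negPow-+P (suc k) p q = trans (cong -P_ (negPow-+P k p q)) (ListP.map-++ _ (negPow k p) (negPow k q))

  sumP-cong : {f g : A → Poly n} (xs : List A) → (∀ x → f x ≋ g x) → sumP (map f xs) ≋ sumP (map g xs)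
  sumP-cong [] e = ≋-refl
  sumP-cong (x ∷ xs) e = +P-cong (e x) (sumP-cong xs e)

  sumP-++ : (f : A → Poly n) (xs ys : List A) → sumP (map f (xs ++ ys)) ≡ sumP (map f xs) +P sumP (map f ys)
  sumP-++ f xs ys = trans (cong sumP (ListP.map-++ f xs ys)) (sym (ListP.concat-++ (map f xs) (map f ys)))

  sumP-+P : (f g : A → Poly n) (xs : List A) →
            sumP (map (λ x → f x +P g x) xs) ≋ sumP (map f xs) +P sumP (map g xs)
  sumP-+P f g xs = coeffwise λ mo → begin
    coeff (sumP (map (λ x → f x +P g x) xs)) mo                ≡⟨ coeff-sumP _ xs mo ⟩
    ∑ xs (λ x → coeff (f x +P g x) mo)                         ≡⟨ ∑-cong xs (λ x → coeff-++ (f x) (g x) mo) ⟩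
    ∑ xs (λ x → coeff (f x) mo +ℤ coeff (g x) mo)              ≡⟨ ∑-distrib-+ xs _ _ ⟩
    ∑ xs (λ x → coeff (f x) mo) +ℤ ∑ xs (λ x → coeff (g x) mo)
      ≡⟨ cong₂ _+ℤ_ (coeff-sumP f xs mo) (coeff-sumP g xs mo) ⟨
    coeff (sumP (map f xs)) mo +ℤ coeff (sumP (map g xs)) mo   ≡⟨ coeff-++ (sumP (map f xs)) _ mo ⟨
    coeff (sumP (map f xs) +P sumP (map g xs)) mo              ∎
    where open ≡-Reasoning

module _ {n : ℕ} where

  infixl 7 _·M_ _/M_ _·T_

  _·M_ : Mono n → Mono n → Mono n
  a ·M b = zipWith ℕ._+_ (proj₁ a) (proj₁ b) , zipWith ℕ._+_ (proj₂ a) (proj₂ b)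

  _/M_ : Mono n → Mono n → Mono n
  a /M b = zipWith _∸_ (proj₁ a) (proj₁ b) , zipWith _∸_ (proj₂ a) (proj₂ b)

  _·T_ : ℤ × Mono n → ℤ × Mono n → ℤ × Mono n
  t ·T u = proj₁ t *ℤ proj₁ u , proj₂ t ·M proj₂ u

  ·M-/M : (a e : Mono n) → (a ·M e) /M a ≡ e
  ·M-/M a e = cong₂ _,_ (cancel (proj₁ a) (proj₁ e)) (cancel (proj₂ a) (proj₂ e))
    where
    cancel : ∀ {k} (u v : Vec ℕ k) → zipWith _∸_ (zipWith ℕ._+_ u v) u ≡ v
    cancel [] [] = refl
    cancel (x ∷ u) (y ∷ v) = cong₂ _∷_ (ℕP.m+n∸m≡n x y) (cancel u v)

  -- Because of truncated subtraction, a ·M (mo /M a) ≡ mo says exactly that xᵃ divides mo.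
  coeff-shift : (c : ℤ) (a : Mono n) (q : Poly n) (mo : Mono n) → a ·M (mo /M a) ≡ mo →
                coeff (map ((c , a) ·T_) q) mo ≡ c *ℤ coeff q (mo /M a)
  coeff-shift c a [] mo a∣mo = sym (ℤP.*-zeroʳ c)
  coeff-shift c a ((d , e) ∷ q) mo a∣mo with (a ·M e) ≟M mo | e ≟M (mo /M a)
  ... | yes _     | yes _  =
    trans (cong (c *ℤ d +ℤ_) (coeff-shift c a q mo a∣mo)) (sym (ℤP.*-distribˡ-+ c d _))
  ... | yes ae≡mo | no e≢  = ⊥-elim (e≢ (trans (sym (·M-/M a e)) (cong (_/M a) ae≡mo)))
  ... | no ae≢mo  | yes e≡ = ⊥-elim (ae≢mo (trans (cong (a ·M_) e≡) a∣mo))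
  ... | no _      | no _   =
    trans (ℤP.+-identityˡ _) (trans (coeff-shift c a q mo a∣mo) (cong (c *ℤ_) (sym (ℤP.+-identityˡ _))))

  coeff-shift-∤ : (c : ℤ) (a : Mono n) (q : Poly n) (mo : Mono n) → a ·M (mo /M a) ≢ mo →
                  coeff (map ((c , a) ·T_) q) mo ≡ + 0
  coeff-shift-∤ c a [] mo a∤mo = refl
  coeff-shift-∤ c a ((d , e) ∷ q) mo a∤mo with (a ·M e) ≟M mo
  ... | yes ae≡mo = ⊥-elim (a∤mo (subst (λ m → a ·M (m /M a) ≡ m) ae≡mo (cong (a ·M_) (·M-/M a e))))
  ... | no _      = trans (ℤP.+-identityˡ _) (coeff-shift-∤ c a q mo a∤mo)

  shift-cong : (t : ℤ × Mono n) {q q′ : Poly n} → q ≋ q′ → map (t ·T_) q ≋ map (t ·T_) q′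
  shift-cong (c , a) {q} {q′} e = coeffwise λ mo → by-divisibility mo ((a ·M (mo /M a)) ≟M mo)
    where
    by-divisibility : ∀ mo → Dec (a ·M (mo /M a) ≡ mo) →
                      coeff (map ((c , a) ·T_) q) mo ≡ coeff (map ((c , a) ·T_) q′) mo
    by-divisibility mo (yes a∣mo) = trans (coeff-shift c a q mo a∣mo)
      (trans (cong (c *ℤ_) (coeff-≡ e (mo /M a))) (sym (coeff-shift c a q′ mo a∣mo)))
    by-divisibility mo (no a∤mo) = trans (coeff-shift-∤ c a q mo a∤mo) (sym (coeff-shift-∤ c a q′ mo a∤mo))

  *P-congʳ : (p : Poly n) {q q′ : Poly n} → q ≋ q′ → p *P q ≋ p *P q′
  *P-congʳ [] e = ≋-refl
  *P-congʳ (t ∷ p) e = +P-cong (shift-cong t e) (*P-congʳ p e)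

  *P-zeroʳ : (p : Poly n) → p *P 0P ≡ 0P
  *P-zeroʳ [] = refl
  *P-zeroʳ (t ∷ p) = *P-zeroʳ p

  *P-distribˡ-+P : (p q r : Poly n) → p *P (q +P r) ≋ p *P q +P p *P r
  *P-distribˡ-+P [] q r = ≋-refl
  *P-distribˡ-+P (t ∷ p) q r = ≋-trans
    (+P-cong (≡⇒≋ (ListP.map-++ (t ·T_) q r)) (*P-distribˡ-+P p q r))
    (+P-interchange (map (t ·T_) q) (map (t ·T_) r) (p *P q) (p *P r))

  *P-sumP : (p : Poly n) (f : A → Poly n) (xs : List A) → p *P sumP (map f xs) ≋ sumP (map (λ x → p *P f x) xs)
  *P-sumP p f [] = ≡⇒≋ (*P-zeroʳ p)
  *P-sumP p f (x ∷ xs) = ≋-trans (*P-distribˡ-+P p (f x) _) (+P-cong ≋-refl (*P-sumP p f xs))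

  *P-scaleP : (p : Poly n) (c : ℤ) (q : Poly n) → p *P scaleP c q ≡ scaleP c (p *P q)
  *P-scaleP [] c q = refl
  *P-scaleP (t ∷ p) c q =
    trans (cong₂ _++_ (shift-scale q) (*P-scaleP p c q)) (sym (ListP.map-++ _ (map (t ·T_) q) (p *P q)))
    where
    shift-scale : ∀ q → map (t ·T_) (scaleP c q) ≡ scaleP c (map (t ·T_) q)
    shift-scale [] = refl
    shift-scale ((d , e) ∷ q) = cong₂ _∷_ (cong (_, _) (ℤ*.x∙yz≈y∙xz (proj₁ t) c d)) (shift-scale q)

updateAt-+-inʳ : ∀ {k} (u v : Vec ℕ k) (w : Fin k) (f : ℕ → ℕ) → lookup u w ≡ 0 →
                 updateAt (zipWith ℕ._+_ u v) w f ≡ zipWith ℕ._+_ u (updateAt v w f)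
updateAt-+-inʳ (x ∷ u) (y ∷ v) zero f refl = refl
updateAt-+-inʳ (x ∷ u) (y ∷ v) (suc w) f uw≡0 = cong (x ℕ.+ y ∷_) (updateAt-+-inʳ u v w f uw≡0)

updateAt-+-inˡ : ∀ {k} (u v : Vec ℕ k) (w : Fin k) (f : ℕ → ℕ) → lookup v w ≡ 0 →
                 updateAt (zipWith ℕ._+_ u v) w f ≡ zipWith ℕ._+_ (updateAt u w f) v
updateAt-+-inˡ (x ∷ u) (y ∷ v) zero f refl =
  cong (_∷ zipWith ℕ._+_ u v) (trans (cong f (ℕP.+-identityʳ x)) (sym (ℕP.+-identityʳ (f x))))
updateAt-+-inˡ (x ∷ u) (y ∷ v) (suc w) f vw≡0 = cong (x ℕ.+ y ∷_) (updateAt-+-inˡ u v w f vw≡0)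

module _ {n : ℕ} where

  raiseX : Fin n → Mono n → Mono n
  raiseX i mo = updateAt (proj₁ mo) i suc , proj₂ mo

  lowerX : Fin n → Mono n → Mono n
  lowerX i mo = updateAt (proj₁ mo) i (_∸ 1) , proj₂ mo

  ∂term : Fin n → ℤ × Mono n → ℤ × Mono n
  ∂term i t = proj₁ t *ℤ + lookup (proj₁ (proj₂ t)) i , lowerX i (proj₂ t)

  lowerX-raiseX : (i : Fin n) (mo : Mono n) → lowerX i (raiseX i mo) ≡ mo
  lowerX-raiseX i (a , b) = cong (_, b) (trans (VecP.updateAt-updateAt i a) (VecP.updateAt-id i a))

  lowerX≡⇒≡raiseX : (i : Fin n) {a mo : Mono n} {r : ℕ} → lookup (proj₁ a) i ≡ suc r →
                    lowerX i a ≡ mo → a ≡ raiseX i mo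
  lowerX≡⇒≡raiseX i {a , b} aᵢ≡ refl = cong (_, b) (sym (trans (VecP.updateAt-updateAt i a)
    (VecP.updateAt-id-local i a (trans (cong (λ x → suc (x ∸ 1)) aᵢ≡) (sym aᵢ≡)))))

  -- The coefficient of mo in ∂ᵢ p comes from the single monomial raiseX i mo of p.
  coeff-∂-term : (i : Fin n) (c : ℤ) (a mo : Mono n) →
    (if does (lowerX i a ≟M mo) then c *ℤ + lookup (proj₁ a) i else + 0)
      ≡ + suc (lookup (proj₁ mo) i) *ℤ (if does (a ≟M raiseX i mo) then c else + 0)
  coeff-∂-term i c a mo with a ≟M raiseX i mo
  ... | yes refl rewrite dec-true (lowerX i (raiseX i mo) ≟M mo) (lowerX-raiseX i mo)
                       | VecP.lookup∘updateAt i {suc} (proj₁ mo) = ℤP.*-comm c (+ suc (lookup (proj₁ mo) i))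
  ... | no a≢ with lookup (proj₁ a) i in aᵢ≡
  ...   | zero = trans (vanishes (does (lowerX i a ≟M mo))) (sym (ℤP.*-zeroʳ (+ suc (lookup (proj₁ mo) i))))
    where
    vanishes : ∀ b → (if b then c *ℤ + 0 else + 0) ≡ + 0
    vanishes true = ℤP.*-zeroʳ c
    vanishes false = refl
  ...   | suc r rewrite dec-false (lowerX i a ≟M mo) (a≢ ∘ lowerX≡⇒≡raiseX i aᵢ≡) =
    sym (ℤP.*-zeroʳ (+ suc (lookup (proj₁ mo) i)))

  coeff-∂x : (i : Fin n) (p : Poly n) (mo : Mono n) →
             coeff (∂x i p) mo ≡ + suc (lookup (proj₁ mo) i) *ℤ coeff p (raiseX i mo)
  coeff-∂x i [] mo = sym (ℤP.*-zeroʳ (+ suc (lookup (proj₁ mo) i)))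
  coeff-∂x i ((c , a) ∷ p) mo = trans (cong₂ _+ℤ_ (coeff-∂-term i c a mo) (coeff-∂x i p mo))
    (sym (ℤP.*-distribˡ-+ (+ suc (lookup (proj₁ mo) i)) (if does (a ≟M raiseX i mo) then c else + 0) _))

  ∂x-cong : (i : Fin n) {p q : Poly n} → p ≋ q → ∂x i p ≋ ∂x i q
  ∂x-cong i {p} {q} e = coeffwise λ mo → trans (coeff-∂x i p mo)
    (trans (cong (+ suc (lookup (proj₁ mo) i) *ℤ_) (coeff-≡ e (raiseX i mo))) (sym (coeff-∂x i q mo)))

  ∂x-++ : (i : Fin n) (p q : Poly n) → ∂x i (p ++ q) ≡ ∂x i p ++ ∂x i q
  ∂x-++ i = ListP.map-++ (∂term i)

  ∂x-neg : (i : Fin n) (p : Poly n) → ∂x i (-P p) ≡ -P (∂x i p)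
  ∂x-neg i [] = refl
  ∂x-neg i ((c , a) ∷ p) = cong₂ _∷_ (cong (_, _) (sym (ℤP.neg-distribˡ-* c _))) (∂x-neg i p)

  ∂x-negPow : (i : Fin n) (k : ℕ) (p : Poly n) → ∂x i (negPow k p) ≡ negPow k (∂x i p)
  ∂x-negPow i zero p = refl
  ∂x-negPow i (suc k) p = trans (∂x-neg i (negPow k p)) (cong -P_ (∂x-negPow i k p))

  ∂x-sumP : (i : Fin n) (f : A → Poly n) (xs : List A) → ∂x i (sumP (map f xs)) ≡ sumP (map (∂x i ∘ f) xs)
  ∂x-sumP i f [] = refl
  ∂x-sumP i f (x ∷ xs) = trans (∂x-++ i (f x) _) (cong (∂x i (f x) ++_) (∂x-sumP i f xs))

  FreeOf : Fin n → Poly n → Set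
  FreeOf v = All (λ t → lookup (proj₁ (proj₂ t)) v ≡ 0)

  FreeOf-++ : {v : Fin n} {p q : Poly n} → FreeOf v p → FreeOf v q → FreeOf v (p ++ q)
  FreeOf-++ = AllP.++⁺

  FreeOf-negPow : {v : Fin n} (k : ℕ) {p : Poly n} → FreeOf v p → FreeOf v (negPow k p)
  FreeOf-negPow zero fp = fp
  FreeOf-negPow (suc k) fp = AllP.map⁺ (All.map id (FreeOf-negPow k fp))

  FreeOf-sumP : {v : Fin n} (f : A → Poly n) (xs : List A) → (∀ x → FreeOf v (f x)) →
                FreeOf v (sumP (map f xs))
  FreeOf-sumP f [] free = []
  FreeOf-sumP f (x ∷ xs) free = FreeOf-++ (free x) (FreeOf-sumP f xs free)

  FreeOf-*P : {v : Fin n} {p q : Poly n} → FreeOf v p → FreeOf v q → FreeOf v (p *P q)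
  FreeOf-*P [] fq = []
  FreeOf-*P {v} {t ∷ p} (tᵥ≡0 ∷ fp) fq =
    FreeOf-++ (AllP.map⁺ (All.map (λ {u} → shifted u) fq)) (FreeOf-*P fp fq)
    where
    shifted : ∀ u → lookup (proj₁ (proj₂ u)) v ≡ 0 → lookup (proj₁ (proj₂ (t ·T u))) v ≡ 0
    shifted u uᵥ≡0 = trans (VecP.lookup-zipWith ℕ._+_ v (proj₁ (proj₂ t)) (proj₁ (proj₂ u)))
                           (cong₂ ℕ._+_ tᵥ≡0 uᵥ≡0)

  FreeOf-∂x : {v : Fin n} (w : Fin n) {p : Poly n} → FreeOf v p → FreeOf v (∂x w p)
  FreeOf-∂x {v} w fp = AllP.map⁺ (All.map (λ {t} → lowered t) fp)
    where
    lowered : ∀ t → lookup (proj₁ (proj₂ t)) v ≡ 0 → lookup (proj₁ (lowerX w (proj₂ t))) v ≡ 0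
    lowered t tᵥ≡0 with w Fin.≟ v
    ... | yes refl = trans (VecP.lookup∘updateAt w (proj₁ (proj₂ t))) (cong (_∸ 1) tᵥ≡0)
    ... | no w≢v = trans (VecP.lookup∘updateAt′ v w (w≢v ∘ sym) (proj₁ (proj₂ t))) tᵥ≡0

  FreeOf-monoXY : {v : Fin n} (w : Fin n) (a b : ℕ) → w ≢ v → FreeOf v (monoXY w a b)
  FreeOf-monoXY {v} w a b w≢v =
    trans (VecP.lookup∘updateAt′ v w (w≢v ∘ sym) (replicate n 0)) (VecP.lookup-replicate v 0) ∷ []

  FreeOf-1P : {v : Fin n} → FreeOf v 1P
  FreeOf-1P {v} = VecP.lookup-replicate v 0 ∷ []

  ∂x-*P-free : (w : Fin n) {p : Poly n} → FreeOf w p → (q : Poly n) → ∂x w (p *P q) ≡ p *P ∂x w q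
  ∂x-*P-free w [] q = refl
  ∂x-*P-free w {t ∷ p} (tw≡0 ∷ fp) q = trans (∂x-++ w (map (t ·T_) q) (p *P q))
    (cong₂ _++_ (trans (sym (ListP.map-∘ q)) (trans (ListP.map-cong commute q) (ListP.map-∘ q)))
                (∂x-*P-free w fp q))
    where
    commute : ∀ u → ∂term w (t ·T u) ≡ t ·T ∂term w u
    commute (d , e₁ , e₂) = cong₂ _,_
      (trans (cong (λ z → (proj₁ t *ℤ d) *ℤ + z) exponent) (ℤP.*-assoc (proj₁ t) d (+ lookup e₁ w)))
      (cong (_, _) (updateAt-+-inʳ (proj₁ (proj₂ t)) e₁ w (_∸ 1) tw≡0))
      where
      exponent : lookup (zipWith ℕ._+_ (proj₁ (proj₂ t)) e₁) w ≡ lookup e₁ w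
      exponent = trans (VecP.lookup-zipWith ℕ._+_ w (proj₁ (proj₂ t)) e₁) (cong (ℕ._+ lookup e₁ w) tw≡0)

  ∂x-monoXY-*P : (v : Fin n) (a b : ℕ) {q : Poly n} → FreeOf v q →
                 ∂x v (monoXY v a b *P q) ≡ scaleP (+ a) (monoXY v (a ∸ 1) b *P q)
  ∂x-monoXY-*P v a b {q} fq =
    trans (∂x-++ v (map (t ·T_) q) []) (trans (cong (_++ []) (trans (sym (ListP.map-∘ q))
      (trans (ListP.map-cong-local (All.map (λ {u} → differentiate u) fq)) (ListP.map-∘ q))))
      (sym (ListP.map-++ _ (map (t′ ·T_) q) [])))
    where
    xᵃ = updateAt (replicate n 0) v (λ _ → a)
    t t′ : ℤ × Mono n
    t = + 1 , xᵃ , updateAt (replicate n 0) v (λ _ → b)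
    t′ = + 1 , updateAt (replicate n 0) v (λ _ → a ∸ 1) , proj₂ (proj₂ t)
    differentiate : ∀ u → lookup (proj₁ (proj₂ u)) v ≡ 0 →
                    ∂term v (t ·T u) ≡ (+ a *ℤ proj₁ (t′ ·T u) , proj₂ (t′ ·T u))
    differentiate (d , e₁ , e₂) uᵥ≡0 = cong₂ _,_
      (trans (cong (λ z → (+ 1 *ℤ d) *ℤ + z) exponent) (ℤP.*-comm (+ 1 *ℤ d) (+ a)))
      (cong (_, _) (trans (updateAt-+-inˡ xᵃ e₁ v (_∸ 1) uᵥ≡0)
                          (cong (λ z → zipWith ℕ._+_ z e₁) (VecP.updateAt-updateAt v (replicate n 0)))))
      where
      exponent : lookup (zipWith ℕ._+_ xᵃ e₁) v ≡ a
      exponent = trans (VecP.lookup-zipWith ℕ._+_ v xᵃ e₁)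
        (trans (cong₂ ℕ._+_ (VecP.lookup∘updateAt v (replicate n 0)) uᵥ≡0) (ℕP.+-identityʳ a))

-- Elementary symmetric functions of partial derivatives

module _ {n : ℕ} where

  record Linear (φ : Poly n → Poly n) : Set where
    field
      φ-cong : {p q : Poly n} → p ≋ q → φ p ≋ φ q
      φ-0P   : φ 0P ≋ 0P
      φ-+P   : (p q : Poly n) → φ (p +P q) ≋ φ p +P φ q
      φ--P   : (p : Poly n) → φ (-P p) ≋ -P φ p

    φ-negPow : (k : ℕ) (p : Poly n) → φ (negPow k p) ≋ negPow k (φ p)
    φ-negPow zero p = ≋-refl
    φ-negPow (suc k) p = ≋-trans (φ--P (negPow k p)) (-P-cong (φ-negPow k p))

    φ-sumP : (f : A → Poly n) (xs : List A) → φ (sumP (map f xs)) ≋ sumP (map (φ ∘ f) xs)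
    φ-sumP f [] = φ-0P
    φ-sumP f (x ∷ xs) = ≋-trans (φ-+P (f x) _) (+P-cong ≋-refl (φ-sumP f xs))
  open Linear public

  -- e∂ ρ k = eₖ(∂/∂x_{ρ 0}, …, ∂/∂x_{ρ (m-1)}).
  e∂ : ∀ {m} → (Fin m → Fin n) → ℕ → Poly n → Poly n
  e∂ ρ zero p = p
  e∂ {zero} ρ (suc k) p = 0P
  e∂ {suc m} ρ (suc k) p = e∂ (ρ ∘ suc) (suc k) p +P ∂x (ρ zero) (e∂ (ρ ∘ suc) k p)

  e∂-linear : ∀ {m} (ρ : Fin m → Fin n) (k : ℕ) → Linear (e∂ ρ k)
  e∂-linear ρ zero = record
    { φ-cong = id ; φ-0P = ≋-refl ; φ-+P = λ _ _ → ≋-refl ; φ--P = λ _ → ≋-refl }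
  e∂-linear {zero} ρ (suc k) = record
    { φ-cong = λ _ → ≋-refl ; φ-0P = ≋-refl ; φ-+P = λ _ _ → ≋-refl ; φ--P = λ _ → ≋-refl }
  e∂-linear {suc m} ρ (suc k) = record
    { φ-cong = λ e → +P-cong (φ-cong E₁ e) (∂x-cong (ρ zero) (φ-cong E₀ e))
    ; φ-0P = +P-cong (φ-0P E₁) (∂x-cong (ρ zero) (φ-0P E₀))
    ; φ-+P = additive
    ; φ--P = λ p → ≋-trans
        (+P-cong (φ--P E₁ p) (≋-trans (∂x-cong (ρ zero) (φ--P E₀ p)) (≡⇒≋ (∂x-neg (ρ zero) (e₀ p)))))
        (≡⇒≋ (sym (ListP.map-++ _ (e₁ p) (∂₀ (e₀ p))))) }
    where
    E₀ = e∂-linear (ρ ∘ suc) k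
    E₁ = e∂-linear (ρ ∘ suc) (suc k)
    e₀ = e∂ (ρ ∘ suc) k
    e₁ = e∂ (ρ ∘ suc) (suc k)
    ∂₀ = ∂x (ρ zero)
    additive : (p q : Poly n) → e∂ ρ (suc k) (p +P q) ≋ e∂ ρ (suc k) p +P e∂ ρ (suc k) q
    additive p q = begin
      e₁ (p +P q) +P ∂₀ (e₀ (p +P q))
        ≈⟨ +P-cong (φ-+P E₁ p q) (∂x-cong (ρ zero) (φ-+P E₀ p q)) ⟩
      (e₁ p +P e₁ q) +P ∂₀ (e₀ p +P e₀ q)
        ≡⟨ cong ((e₁ p +P e₁ q) +P_) (∂x-++ (ρ zero) (e₀ p) (e₀ q)) ⟩
      (e₁ p +P e₁ q) +P (∂₀ (e₀ p) +P ∂₀ (e₀ q))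
        ≈⟨ +P-interchange (e₁ p) (e₁ q) (∂₀ (e₀ p)) (∂₀ (e₀ q)) ⟩
      (e₁ p +P ∂₀ (e₀ p)) +P (e₁ q +P ∂₀ (e₀ q)) ∎
      where open ≋-Reasoning

  FreeOf-e∂ : ∀ {m} {v : Fin n} (ρ : Fin m → Fin n) (k : ℕ) {p : Poly n} →
              FreeOf v p → FreeOf v (e∂ ρ k p)
  FreeOf-e∂ ρ zero fp = fp
  FreeOf-e∂ {zero} ρ (suc k) fp = []
  FreeOf-e∂ {suc m} ρ (suc k) fp =
    FreeOf-++ (FreeOf-e∂ (ρ ∘ suc) (suc k) fp) (FreeOf-∂x (ρ zero) (FreeOf-e∂ (ρ ∘ suc) k fp))

  e∂-*P-free : ∀ {m} (ρ : Fin m → Fin n) (k : ℕ) {p : Poly n} → (∀ i → FreeOf (ρ i) p) → (q : Poly n) →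
               e∂ ρ k (p *P q) ≋ p *P e∂ ρ k q
  e∂-*P-free ρ zero fp q = ≋-refl
  e∂-*P-free {zero} ρ (suc k) {p} fp q = ≡⇒≋ (sym (*P-zeroʳ p))
  e∂-*P-free {suc m} ρ (suc k) {p} fp q = ≋-trans
    (+P-cong (e∂-*P-free (ρ ∘ suc) (suc k) (fp ∘ suc) q)
             (≋-trans (∂x-cong (ρ zero) (e∂-*P-free (ρ ∘ suc) k (fp ∘ suc) q))
                      (≡⇒≋ (∂x-*P-free (ρ zero) (fp zero) (e∂ (ρ ∘ suc) k q)))))
    (≋-sym (*P-distribˡ-+P p _ _))

subsets : (m k : ℕ) → List (Subset m)
subsets zero zero = [] ∷ []
subsets zero (suc k) = []
subsets (suc m) zero = map (false ∷_) (subsets m zero)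
subsets (suc m) (suc k) = map (true ∷_) (subsets m k) ++ map (false ∷_) (subsets m (suc k))

subsets-zero : (m : ℕ) → subsets m 0 ≡ replicate m false ∷ []
subsets-zero zero = refl
subsets-zero (suc m) = cong (map (false ∷_)) (subsets-zero m)

-- The (k - 1)-subsets, none when k = 0: what remains of the k-subsets containing a given element.
subsets⁻ : (m k : ℕ) → List (Subset m)
subsets⁻ m zero = []
subsets⁻ m (suc k) = subsets m k

∑-subsets-insertAt : (m : ℕ) (j : Fin (suc m)) (k : ℕ) (F : Subset (suc m) → ℤ) →
  ∑ (subsets (suc m) k) F
    ≡ ∑ (subsets m k) (λ T → F (insertAt T j false)) +ℤ ∑ (subsets⁻ m k) (λ T → F (insertAt T j true))
∑-subsets-insertAt m zero zero F = trans (∑-map (false ∷_) (subsets m zero) F) (sym (ℤP.+-identityʳ _))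
∑-subsets-insertAt m zero (suc k) F = begin
  ∑ (map (true ∷_) (subsets m k) ++ map (false ∷_) (subsets m (suc k))) F
    ≡⟨ ∑-++ (map (true ∷_) (subsets m k)) _ F ⟩
  ∑ (map (true ∷_) (subsets m k)) F +ℤ ∑ (map (false ∷_) (subsets m (suc k))) F
    ≡⟨ cong₂ _+ℤ_ (∑-map (true ∷_) (subsets m k) F) (∑-map (false ∷_) (subsets m (suc k)) F) ⟩
  ∑ (subsets m k) (F ∘ (true ∷_)) +ℤ ∑ (subsets m (suc k)) (F ∘ (false ∷_))
    ≡⟨ ℤP.+-comm (∑ (subsets m k) (F ∘ (true ∷_))) _ ⟩
  ∑ (subsets m (suc k)) (F ∘ (false ∷_)) +ℤ ∑ (subsets m k) (F ∘ (true ∷_)) ∎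
  where open ≡-Reasoning
∑-subsets-insertAt (suc m) (suc j) zero F =
  trans (∑-map (false ∷_) (subsets (suc m) zero) F)
    (trans (∑-subsets-insertAt m j zero (F ∘ (false ∷_)))
      (cong (_+ℤ + 0) (sym (∑-map (false ∷_) (subsets m zero) (λ T → F (insertAt T (suc j) false))))))
∑-subsets-insertAt (suc m) (suc j) (suc k) F = begin
  ∑ (map (true ∷_) (subsets (suc m) k) ++ map (false ∷_) (subsets (suc m) (suc k))) F
    ≡⟨ split-head (subsets (suc m) k) (subsets (suc m) (suc k)) F ⟩
  ∑ (subsets (suc m) k) (F ∘ (true ∷_)) +ℤ ∑ (subsets (suc m) (suc k)) (F ∘ (false ∷_))
    ≡⟨ cong₂ _+ℤ_ (∑-subsets-insertAt m j k (F ∘ (true ∷_)))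
                  (∑-subsets-insertAt m j (suc k) (F ∘ (false ∷_))) ⟩
  (a +ℤ b) +ℤ (c +ℤ d)
    ≡⟨ rearrange a b c d ⟩
  (a +ℤ c) +ℤ (d +ℤ b)
    ≡⟨ cong₂ _+ℤ_ (split-head (subsets m k) (subsets m (suc k)) F₀) (∑-subsets-insertAt m zero k F₁) ⟨
  ∑ (subsets (suc m) (suc k)) F₀ +ℤ ∑ (subsets (suc m) k) F₁ ∎
  where
  open ≡-Reasoning
  split-head : ∀ {m′} (Ts Ts′ : List (Subset m′)) (G : Subset (suc m′) → ℤ) →
               ∑ (map (true ∷_) Ts ++ map (false ∷_) Ts′) G ≡ ∑ Ts (G ∘ (true ∷_)) +ℤ ∑ Ts′ (G ∘ (false ∷_))
  split-head Ts Ts′ G =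
    trans (∑-++ (map (true ∷_) Ts) _ G) (cong₂ _+ℤ_ (∑-map (true ∷_) Ts G) (∑-map (false ∷_) Ts′ G))
  F₀ F₁ : Subset (suc m) → ℤ
  F₀ T = F (insertAt T (suc j) false)
  F₁ T = F (insertAt T (suc j) true)
  a = ∑ (subsets m k) (λ T → F (true ∷ insertAt T j false))
  b = ∑ (subsets⁻ m k) (λ T → F (true ∷ insertAt T j true))
  c = ∑ (subsets m (suc k)) (λ T → F (false ∷ insertAt T j false))
  d = ∑ (subsets m k) (λ T → F (false ∷ insertAt T j true))
  rearrange : ∀ a b c d → (a +ℤ b) +ℤ (c +ℤ d) ≡ (a +ℤ c) +ℤ (d +ℤ b)
  rearrange = solve-∀

filter-map : {P : B → Set} {Q : A → Set} (P? : ∀ y → Dec (P y)) (Q? : ∀ x → Dec (Q x)) (f : A → B) →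
             (∀ x → does (P? (f x)) ≡ does (Q? x)) →
             (xs : List A) → List.filter P? (map f xs) ≡ map f (List.filter Q? xs)
filter-map P? Q? f same [] = refl
filter-map P? Q? f same (x ∷ xs) with does (P? (f x)) | does (Q? x) | same x
... | true  | true  | refl = cong (f x ∷_) (filter-map P? Q? f same xs)
... | false | false | refl = filter-map P? Q? f same xs

kSubsets≡subsets : (m k : ℕ) → kSubsets m k ≡ subsets m k
kSubsets≡subsets zero zero = refl
kSubsets≡subsets zero (suc k) = refl
kSubsets≡subsets (suc m) zero =
  trans (ListP.filter-++ ofSize0 (map (true ∷_) (allSubsets m)) (map (false ∷_) (allSubsets m)))
    (cong₂ _++_ (ListP.filter-none ofSize0 (AllP.map⁺ (All.universal (λ _ ()) (allSubsets m))))
                (trans (filter-map _ _ (false ∷_) (λ _ → refl) (allSubsets m))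
                       (cong (map (false ∷_)) (kSubsets≡subsets m zero))))
  where ofSize0 = λ (S : Subset (suc m)) → ∣ S ∣ ℕ.≟ 0
kSubsets≡subsets (suc m) (suc k) =
  trans (ListP.filter-++ ofSize (map (true ∷_) (allSubsets m)) (map (false ∷_) (allSubsets m)))
    (cong₂ _++_ (trans (filter-map _ _ (true ∷_) (λ _ → refl) (allSubsets m))
                       (cong (map (true ∷_)) (kSubsets≡subsets m k)))
                (trans (filter-map _ _ (false ∷_) (λ _ → refl) (allSubsets m))
                       (cong (map (false ∷_)) (kSubsets≡subsets m (suc k)))))
  where ofSize = λ (S : Subset (suc m)) → ∣ S ∣ ℕ.≟ suc k

module _ {n : ℕ} where

  ∏∂ : ∀ {m} → (Fin m → Fin n) → Subset m → Poly n → Poly n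
  ∏∂ ρ [] p = p
  ∏∂ ρ (b ∷ S) p = if b then ∂x (ρ zero) (∏∂ (ρ ∘ suc) S p) else ∏∂ (ρ ∘ suc) S p

  foldr-∂≡∏∂ : ∀ {m} (ρ : Fin m → Fin n) (S : Subset m) (p : Poly n) →
               foldr (λ i r → if lookup S i then ∂x (ρ i) r else r) p (allFin m) ≡ ∏∂ ρ S p
  foldr-∂≡∏∂ ρ [] p = refl
  foldr-∂≡∏∂ {suc m} ρ (b ∷ S) p = cong (λ r → if b then ∂x (ρ zero) r else r) (begin
    foldr step p (List.tabulate suc)       ≡⟨ cong (foldr step p) (ListP.map-tabulate id suc) ⟨
    foldr step p (map suc (allFin m))      ≡⟨ ListP.foldr-map step suc p (allFin m) ⟩
    foldr (step ∘ suc) p (allFin m)        ≡⟨ foldr-∂≡∏∂ (ρ ∘ suc) S p ⟩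
    ∏∂ (ρ ∘ suc) S p                       ∎)
    where
    open ≡-Reasoning
    step : Fin (suc m) → Poly n → Poly n
    step i r = if lookup (b ∷ S) i then ∂x (ρ i) r else r

  ∑∏∂≋e∂ : ∀ {m} (ρ : Fin m → Fin n) (k : ℕ) (p : Poly n) →
           sumP (map (λ S → ∏∂ ρ S p) (subsets m k)) ≋ e∂ ρ k p
  ∑∏∂≋e∂ {zero} ρ zero p = ≡⇒≋ (ListP.++-identityʳ p)
  ∑∏∂≋e∂ {zero} ρ (suc k) p = ≋-refl
  ∑∏∂≋e∂ {suc m} ρ zero p =
    ≋-trans (≡⇒≋ (cong sumP (sym (ListP.map-∘ (subsets m zero))))) (∑∏∂≋e∂ (ρ ∘ suc) zero p)
  ∑∏∂≋e∂ {suc m} ρ (suc k) p = begin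
    sumP (map ∏∂p (map (true ∷_) (subsets m k) ++ map (false ∷_) (subsets m (suc k))))
      ≡⟨ sumP-++ ∏∂p (map (true ∷_) (subsets m k)) _ ⟩
    sumP (map ∏∂p (map (true ∷_) (subsets m k))) +P sumP (map ∏∂p (map (false ∷_) (subsets m (suc k))))
      ≡⟨ cong₂ _+P_ (trans (cong sumP (sym (ListP.map-∘ (subsets m k)))) (sym (∂x-sumP (ρ zero) ∏∂′p (subsets m k))))
                    (cong sumP (sym (ListP.map-∘ (subsets m (suc k))))) ⟩
    ∂x (ρ zero) (sumP (map ∏∂′p (subsets m k))) +P sumP (map ∏∂′p (subsets m (suc k)))
      ≈⟨ +P-comm (∂x (ρ zero) (sumP (map ∏∂′p (subsets m k)))) _ ⟩
    sumP (map ∏∂′p (subsets m (suc k))) +P ∂x (ρ zero) (sumP (map ∏∂′p (subsets m k)))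
      ≈⟨ +P-cong (∑∏∂≋e∂ (ρ ∘ suc) (suc k) p) (∂x-cong (ρ zero) (∑∏∂≋e∂ (ρ ∘ suc) k p)) ⟩
    e∂ ρ (suc k) p ∎
    where
    open ≋-Reasoning
    ∏∂p = λ S → ∏∂ ρ S p
    ∏∂′p = λ S → ∏∂ (ρ ∘ suc) S p

  eOp≋e∂ : (k : ℕ) (p : Poly n) → eOp k p ≋ e∂ id k p
  eOp≋e∂ k p = ≋-trans
    (≡⇒≋ (cong sumP (trans (ListP.map-cong (λ S → foldr-∂≡∏∂ id S p) (kSubsets n k))
                           (cong (map (λ S → ∏∂ id S p)) (kSubsets≡subsets n k)))))
    (∑∏∂≋e∂ id k p)

-- Lattice determinants in a selection of the variables

punchIn-inject₁≗punchIn-suc : ∀ {m} (C : Fin (suc m) → A) (i : Fin m) → C (inject₁ i) ≡ C (suc i) →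
                              ∀ x → C (punchIn (inject₁ i) x) ≡ C (punchIn (suc i) x)
punchIn-inject₁≗punchIn-suc C zero C₀≡C₁ zero = sym C₀≡C₁
punchIn-inject₁≗punchIn-suc C zero C₀≡C₁ (suc x) = refl
punchIn-inject₁≗punchIn-suc C (suc i) Cᵢ≡Cᵢ₊₁ zero = refl
punchIn-inject₁≗punchIn-suc C (suc i) Cᵢ≡Cᵢ₊₁ (suc x) = punchIn-inject₁≗punchIn-suc (C ∘ suc) i Cᵢ≡Cᵢ₊₁ x

adjacent-punchIn : ∀ {m} (j : Fin (suc (suc m))) (i : Fin (suc m)) → j ≢ inject₁ i → j ≢ suc i →
                   ∃ λ i′ → punchIn j (inject₁ i′) ≡ inject₁ i × punchIn j (suc i′) ≡ suc i
adjacent-punchIn zero zero j≢i j≢i+1 = ⊥-elim (j≢i refl)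
adjacent-punchIn zero (suc i) j≢i j≢i+1 = i , refl , refl
adjacent-punchIn (suc zero) zero j≢i j≢i+1 = ⊥-elim (j≢i+1 refl)
adjacent-punchIn {suc m} (suc (suc j)) zero j≢i j≢i+1 = zero , refl , refl
adjacent-punchIn {suc m} (suc j) (suc i) j≢i j≢i+1
  with adjacent-punchIn j i (j≢i ∘ cong suc) (j≢i+1 ∘ cong suc)
... | i′ , eq₁ , eq₂ = suc i′ , cong suc eq₁ , cong suc eq₂

inject₁≢suc : ∀ {m} (i : Fin m) → inject₁ i ≢ suc i
inject₁≢suc i eq = ℕP.1+n≢n (sym (trans (sym (FinP.toℕ-inject₁ i)) (cong toℕ eq)))

toℕ-adjacent : ∀ {m} (a b : Fin (suc m)) → toℕ b ≡ suc (toℕ a) → ∃ λ i → a ≡ inject₁ i × b ≡ suc i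
toℕ-adjacent zero (suc zero) refl = zero , refl , refl
toℕ-adjacent {suc m} (suc a) (suc b) b≡a+1 with toℕ-adjacent a b (ℕP.suc-injective b≡a+1)
... | i , refl , refl = suc i , refl , refl

module _ {n : ℕ} where

  xy : Fin n → Cell → Poly n
  xy v c = monoXY v (proj₁ c) (proj₂ c)

  Δ⟨_⟩ : ∀ {m} → (Fin m → Fin n) → (Fin m → Cell) → Poly n
  Δ⟨_⟩ {m} ρ C = det m (λ r c → xy (ρ r) (C c))

  minor : ∀ {m} → (Fin (suc m) → Fin n) → (Fin (suc m) → Cell) → Fin (suc m) → Poly n
  minor ρ C j = Δ⟨ ρ ∘ suc ⟩ (C ∘ punchIn j)

  cofactorTerm : ∀ {m} → (Fin (suc m) → Fin n) → (Fin (suc m) → Cell) → Fin (suc m) → Poly n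
  cofactorTerm ρ C j = xy (ρ zero) (C j) *P minor ρ C j

  coeff-Δ : ∀ {m} (ρ : Fin (suc m) → Fin n) (C : Fin (suc m) → Cell) (mo : Mono n) →
            coeff (Δ⟨ ρ ⟩ C) mo ≡ ∑ (allFin (suc m)) (λ j → sign (toℕ j) *ℤ coeff (cofactorTerm ρ C j) mo)
  coeff-Δ {m} ρ C mo = trans (coeff-sumP (λ j → negPow (toℕ j) (cofactorTerm ρ C j)) (allFin (suc m)) mo)
    (∑-cong (allFin (suc m)) λ j → coeff-negPow (toℕ j) (cofactorTerm ρ C j) mo)

  Δ-cong : ∀ {m} (ρ : Fin m → Fin n) {C C′ : Fin m → Cell} → (∀ i → C i ≡ C′ i) → Δ⟨ ρ ⟩ C ≡ Δ⟨ ρ ⟩ C′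
  Δ-cong {zero} ρ C≗C′ = refl
  Δ-cong {suc m} ρ C≗C′ = cong sumP (ListP.map-cong (λ j →
    cong₂ (λ c d → negPow (toℕ j) (xy (ρ zero) c *P d)) (C≗C′ j) (Δ-cong (ρ ∘ suc) (C≗C′ ∘ punchIn j)))
    (allFin (suc m)))

  FreeOf-Δ : ∀ {m} (v : Fin n) (ρ : Fin m → Fin n) (C : Fin m → Cell) → (∀ r → ρ r ≢ v) → FreeOf v (Δ⟨ ρ ⟩ C)
  FreeOf-Δ {zero} v ρ C ρ≢v = FreeOf-1P
  FreeOf-Δ {suc m} v ρ C ρ≢v = FreeOf-sumP _ (allFin (suc m)) λ j → FreeOf-negPow (toℕ j)
    (FreeOf-*P (FreeOf-monoXY (ρ zero) _ _ (ρ≢v zero)) (FreeOf-Δ v (ρ ∘ suc) (C ∘ punchIn j) (ρ≢v ∘ suc)))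

  -- In the first-row expansion the minors off the two equal columns vanish by induction,
  -- and the two remaining terms carry opposite signs.
  Δ-alternating : ∀ {m} (ρ : Fin (suc m) → Fin n) (C : Fin (suc m) → Cell) (i : Fin m) →
                  C (inject₁ i) ≡ C (suc i) → Δ⟨ ρ ⟩ C ≋ 0P
  Δ-alternating {suc m} ρ C i Cᵢ≡Cᵢ₊₁ = coeffwise λ mo → trans (coeff-Δ ρ C mo)
    (trans (∑-allFin-two (suc (suc m)) (term mo) (inject₁ i) (suc i) (inject₁≢suc i) (off-pair mo)) (pair mo))
    where
    term : Mono n → Fin (suc (suc m)) → ℤ
    term mo j = sign (toℕ j) *ℤ coeff (cofactorTerm ρ C j) mo
    off-pair : ∀ mo j → j ≢ inject₁ i → j ≢ suc i → term mo j ≡ + 0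
    off-pair mo j j≢i j≢i+1 with adjacent-punchIn j i j≢i j≢i+1
    ... | i′ , eq₁ , eq₂ = begin
      sign (toℕ j) *ℤ coeff (xy (ρ zero) (C j) *P minor ρ C j) mo
        ≡⟨ cong (sign (toℕ j) *ℤ_) (coeff-≡ (*P-congʳ (xy (ρ zero) (C j)) minor≋0) mo) ⟩
      sign (toℕ j) *ℤ coeff (xy (ρ zero) (C j) *P 0P) mo
        ≡⟨ cong (λ p → sign (toℕ j) *ℤ coeff p mo) (*P-zeroʳ (xy (ρ zero) (C j))) ⟩
      sign (toℕ j) *ℤ + 0
        ≡⟨ ℤP.*-zeroʳ (sign (toℕ j)) ⟩
      + 0 ∎
      where
      open ≡-Reasoning
      minor≋0 : minor ρ C j ≋ 0P
      minor≋0 = Δ-alternating (ρ ∘ suc) (C ∘ punchIn j) i′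
        (trans (cong C eq₁) (trans Cᵢ≡Cᵢ₊₁ (cong C (sym eq₂))))
    pair : ∀ mo → term mo (inject₁ i) +ℤ term mo (suc i) ≡ + 0
    pair mo = begin
      term mo (inject₁ i) +ℤ term mo (suc i)
        ≡⟨ cong (λ t → s *ℤ c +ℤ sign (suc t) *ℤ coeff (cofactorTerm ρ C (suc i)) mo) (FinP.toℕ-inject₁ i) ⟨
      s *ℤ c +ℤ (-ℤ s) *ℤ coeff (cofactorTerm ρ C (suc i)) mo
        ≡⟨ cong (λ p → s *ℤ c +ℤ (-ℤ s) *ℤ coeff p mo) same-term ⟩
      s *ℤ c +ℤ (-ℤ s) *ℤ c
        ≡⟨ cancel s c ⟩
      + 0 ∎
      where
      open ≡-Reasoning
      s = sign (toℕ (inject₁ i))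
      c = coeff (cofactorTerm ρ C (inject₁ i)) mo
      same-term : cofactorTerm ρ C (suc i) ≡ cofactorTerm ρ C (inject₁ i)
      same-term = cong₂ (λ c d → xy (ρ zero) c *P d) (sym Cᵢ≡Cᵢ₊₁)
        (Δ-cong (ρ ∘ suc) (λ x → sym (punchIn-inject₁≗punchIn-suc C i Cᵢ≡Cᵢ₊₁ x)))
      cancel : ∀ s c → s *ℤ c +ℤ (-ℤ s) *ℤ c ≡ + 0
      cancel = solve-∀

  Δ-alternating-toℕ : ∀ {m} (ρ : Fin m → Fin n) (C : Fin m → Cell) (a b : Fin m) →
                      toℕ b ≡ suc (toℕ a) → C a ≡ C b → Δ⟨ ρ ⟩ C ≋ 0P
  Δ-alternating-toℕ {suc m} ρ C a b b≡a+1 Ca≡Cb with toℕ-adjacent a b b≡a+1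
  ... | i , refl , refl = Δ-alternating ρ C i Ca≡Cb

lowerCell : Cell → Cell
lowerCell c = proj₁ c ∸ 1 , proj₂ c

weight : ∀ {m} → (Fin m → Cell) → Subset m → ℕ
weight C [] = 1
weight C (b ∷ T) = (if b then proj₁ (C zero) else 1) ℕ.* weight (C ∘ suc) T

weight-insertAt : ∀ {m} (C : Fin (suc m) → Cell) (j : Fin (suc m)) (b : Bool) (T : Subset m) →
                  weight C (insertAt T j b) ≡ (if b then proj₁ (C j) else 1) ℕ.* weight (C ∘ punchIn j) T
weight-insertAt C zero b T = refl
weight-insertAt {suc m} C (suc j) b (t ∷ T) = begin
  w₀ ℕ.* weight (C ∘ suc) (insertAt T j b) ≡⟨ cong (w₀ ℕ.*_) (weight-insertAt (C ∘ suc) j b T) ⟩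
  w₀ ℕ.* (wⱼ ℕ.* rest)                     ≡⟨ x∙yz≈y∙xz w₀ wⱼ rest ⟩
  wⱼ ℕ.* (w₀ ℕ.* rest)                     ∎
  where
  open ≡-Reasoning
  w₀ = if t then proj₁ (C zero) else 1
  wⱼ = if b then proj₁ (C (suc j)) else 1
  rest = weight (C ∘ suc ∘ punchIn j) T

weight-replicate-false : ∀ {m} (C : Fin m → Cell) → weight C (replicate m false) ≡ 1
weight-replicate-false {zero} C = refl
weight-replicate-false {suc m} C = trans (ℕP.+-identityʳ _) (weight-replicate-false (C ∘ suc))

weight≢0⇒positive : ∀ {m} (C : Fin m → Cell) (T : Subset m) (j : Fin m) → weight C T ≢ 0 →
                    lookup T j ≡ true → 1 ≤ proj₁ (C j)
weight≢0⇒positive C (true ∷ T) zero w≢0 refl with proj₁ (C zero)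
... | zero = ⊥-elim (w≢0 refl)
... | suc _ = ℕ.s≤s ℕ.z≤n
weight≢0⇒positive C (b ∷ T) (suc j) w≢0 Tⱼ =
  weight≢0⇒positive (C ∘ suc) T j (λ w≡0 → w≢0 (trans (cong (w₀ ℕ.*_) w≡0) (ℕP.*-zeroʳ w₀))) Tⱼ
  where w₀ = if b then proj₁ (C zero) else 1

lowerCells-insertAt-punchIn : ∀ {m} (C : Fin (suc m) → Cell) (j : Fin (suc m)) (b : Bool) (T : Subset m) →
                              ∀ i → lowerCells (insertAt T j b) C (punchIn j i) ≡ lowerCells T (C ∘ punchIn j) i
lowerCells-insertAt-punchIn C j b T i rewrite VecP.insertAt-punchIn T j b i = refl

lowerCells-insertAt : ∀ {m} (C : Fin (suc m) → Cell) (j : Fin (suc m)) (b : Bool) (T : Subset m) →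
                      lowerCells (insertAt T j b) C j ≡ (if b then lowerCell (C j) else C j)
lowerCells-insertAt C j b T rewrite VecP.insertAt-lookup T j b = refl

lowerCells-replicate-false : ∀ {m} (C : Fin m → Cell) (i : Fin m) → lowerCells (replicate m false) C i ≡ C i
lowerCells-replicate-false C i rewrite VecP.lookup-replicate i false = refl

-- eₖ(∂/∂x) on a lattice determinant

module _ {n : ℕ} where

  loweringSum : ∀ {m} → (Fin m → Fin n) → (Fin m → Cell) → ℕ → Poly n
  loweringSum {m} ρ C k = sumP (map (λ T → scaleP (+ weight C T) (Δ⟨ ρ ⟩ (lowerCells T C))) (subsets m k))

  loweringSum-zero : ∀ {m} (ρ : Fin m → Fin n) (C : Fin m → Cell) → loweringSum ρ C 0 ≋ Δ⟨ ρ ⟩ C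
  loweringSum-zero {m} ρ C = coeffwise λ mo → begin
    coeff (loweringSum ρ C 0) mo
      ≡⟨ cong (λ Ts → coeff (sumP (map term Ts)) mo) (subsets-zero m) ⟩
    coeff (term none ++ []) mo
      ≡⟨ trans (cong (λ p → coeff p mo) (ListP.++-identityʳ (term none))) (coeff-scaleP (+ weight C none) Δ-none mo) ⟩
    + weight C none *ℤ coeff Δ-none mo
      ≡⟨ cong₂ (λ w p → + w *ℤ coeff p mo) (weight-replicate-false C) (Δ-cong ρ (lowerCells-replicate-false C)) ⟩
    + 1 *ℤ coeff (Δ⟨ ρ ⟩ C) mo
      ≡⟨ ℤP.*-identityˡ _ ⟩
    coeff (Δ⟨ ρ ⟩ C) mo ∎
    where
    open ≡-Reasoning
    term = λ T → scaleP (+ weight C T) (Δ⟨ ρ ⟩ (lowerCells T C))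
    none = replicate m false
    Δ-none = Δ⟨ ρ ⟩ (lowerCells none C)

  coeff-*P-loweringSum : ∀ {m} (p : Poly n) (ρ : Fin m → Fin n) (C : Fin m → Cell) (k : ℕ) (mo : Mono n) →
    coeff (p *P loweringSum ρ C k) mo
      ≡ ∑ (subsets m k) (λ T → + weight C T *ℤ coeff (p *P Δ⟨ ρ ⟩ (lowerCells T C)) mo)
  coeff-*P-loweringSum {m} p ρ C k mo = trans (coeff-≡ (*P-sumP p _ (subsets m k)) mo)
    (trans (coeff-sumP _ (subsets m k) mo) (∑-cong (subsets m k) λ T →
      trans (cong (λ q → coeff q mo) (*P-scaleP p (+ weight C T) (Δ⟨ ρ ⟩ (lowerCells T C))))
            (coeff-scaleP (+ weight C T) (p *P Δ⟨ ρ ⟩ (lowerCells T C)) mo)))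

  -- Both sides of the induction step take this form: the part of e_{k+1} not involving ∂/∂x_{ρ 0}
  -- keeps the cell C j, the part involving it lowers C j and brings down the factor p_j.
  rowTerm : ∀ {m} → (Fin (suc m) → Fin n) → (Fin (suc m) → Cell) → ℕ → Fin (suc m) → Poly n
  rowTerm ρ C k j =
       xy (ρ zero) (C j) *P loweringSum (ρ ∘ suc) (C ∘ punchIn j) (suc k)
    +P scaleP (+ proj₁ (C j)) (xy (ρ zero) (lowerCell (C j)) *P loweringSum (ρ ∘ suc) (C ∘ punchIn j) k)

  rowExpansion : ∀ {m} → (Fin (suc m) → Fin n) → (Fin (suc m) → Cell) → ℕ → Poly n
  rowExpansion {m} ρ C k = sumP (map (λ j → negPow (toℕ j) (rowTerm ρ C k j)) (allFin (suc m)))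

  e∂-first-row : ∀ {m} (ρ : Fin (suc m) → Fin n) (C : Fin (suc m) → Cell) (k : ℕ) → (∀ i → ρ zero ≢ ρ (suc i)) →
    e∂ (ρ ∘ suc) k (Δ⟨ ρ ⟩ C)
      ≋ sumP (map (λ j → negPow (toℕ j) (xy (ρ zero) (C j) *P e∂ (ρ ∘ suc) k (minor ρ C j))) (allFin (suc m)))
  e∂-first-row {m} ρ C k ρ₀-fresh = ≋-trans (φ-sumP E _ (allFin (suc m))) (sumP-cong (allFin (suc m)) λ j →
    ≋-trans (φ-negPow E (toℕ j) (cofactorTerm ρ C j)) (negPow-cong (toℕ j)
      (e∂-*P-free (ρ ∘ suc) k (λ i → FreeOf-monoXY (ρ zero) _ _ (ρ₀-fresh i)) (minor ρ C j))))
    where E = e∂-linear (ρ ∘ suc) k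

  ∂x-first-row : ∀ {m} (v : Fin n) (C : Fin (suc m) → Cell) (X : Fin (suc m) → Poly n) →
    (∀ j → FreeOf v (X j)) →
    ∂x v (sumP (map (λ j → negPow (toℕ j) (xy v (C j) *P X j)) (allFin (suc m))))
      ≡ sumP (map (λ j → negPow (toℕ j) (scaleP (+ proj₁ (C j)) (xy v (lowerCell (C j)) *P X j))) (allFin (suc m)))
  ∂x-first-row {m} v C X free = trans (∂x-sumP v _ (allFin (suc m))) (cong sumP (ListP.map-cong (λ j →
    trans (∂x-negPow v (toℕ j) _) (cong (negPow (toℕ j)) (∂x-monoXY-*P v (proj₁ (C j)) (proj₂ (C j)) (free j))))
    (allFin (suc m))))

  e∂-Δ-step : ∀ {m} (ρ : Fin (suc m) → Fin n) (C : Fin (suc m) → Cell) (k : ℕ) → (∀ i → ρ zero ≢ ρ (suc i)) →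
    (∀ C′ K → e∂ (ρ ∘ suc) K (Δ⟨ ρ ∘ suc ⟩ C′) ≋ loweringSum (ρ ∘ suc) C′ K) →
    e∂ ρ (suc k) (Δ⟨ ρ ⟩ C) ≋ rowExpansion ρ C k
  e∂-Δ-step {m} ρ C k ρ₀-fresh ih = begin
    e∂ ρ′ (suc k) (Δ⟨ ρ ⟩ C) +P ∂x v (e∂ ρ′ k (Δ⟨ ρ ⟩ C))
      ≈⟨ +P-cong (e∂-first-row ρ C (suc k) ρ₀-fresh) (∂x-cong v (e∂-first-row ρ C k ρ₀-fresh)) ⟩
    sumP (map kept Js) +P ∂x v (sumP (map (λ j → negPow (toℕ j) (xy v (C j) *P e∂ ρ′ k (minor ρ C j))) Js))
      ≡⟨ cong (sumP (map kept Js) +P_) (∂x-first-row v C (λ j → e∂ ρ′ k (minor ρ C j))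
           (λ j → FreeOf-e∂ ρ′ k (FreeOf-Δ v ρ′ (C ∘ punchIn j) (λ i → ρ₀-fresh i ∘ sym)))) ⟩
    sumP (map kept Js) +P sumP (map lowered Js)
      ≈⟨ sumP-+P kept lowered Js ⟨
    sumP (map (λ j → kept j +P lowered j) Js)
      ≈⟨ sumP-cong Js (λ j → ≋-trans (≡⇒≋ (sym (negPow-+P (toℕ j) _ _))) (negPow-cong (toℕ j)
           (+P-cong (*P-congʳ (xy v (C j)) (ih (C ∘ punchIn j) (suc k)))
                    (scaleP-cong (+ proj₁ (C j)) (*P-congʳ (xy v (lowerCell (C j))) (ih (C ∘ punchIn j) k)))))) ⟩
    rowExpansion ρ C k ∎
    where
    open ≋-Reasoning
    v = ρ zero
    ρ′ = ρ ∘ suc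
    Js = allFin (suc m)
    kept lowered : Fin (suc m) → Poly n
    kept j = negPow (toℕ j) (xy v (C j) *P e∂ ρ′ (suc k) (minor ρ C j))
    lowered j = negPow (toℕ j) (scaleP (+ proj₁ (C j)) (xy v (lowerCell (C j)) *P e∂ ρ′ k (minor ρ C j)))

  cofactorTerm-insertAt : ∀ {m} (ρ : Fin (suc m) → Fin n) (C : Fin (suc m) → Cell) (j : Fin (suc m)) →
    ∀ b T → cofactorTerm ρ (lowerCells (insertAt T j b) C) j
              ≡ xy (ρ zero) (if b then lowerCell (C j) else C j) *P Δ⟨ ρ ∘ suc ⟩ (lowerCells T (C ∘ punchIn j))
  cofactorTerm-insertAt ρ C j b T = cong₂ (λ c d → xy (ρ zero) c *P d) (lowerCells-insertAt C j b T)
    (Δ-cong (ρ ∘ suc) (lowerCells-insertAt-punchIn C j b T))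

  -- The subsets containing column j lower the cell C j and contribute the factor p_j to the weight.
  ∑-column : ∀ {m} (ρ : Fin (suc m) → Fin n) (C : Fin (suc m) → Cell) (k : ℕ) (j : Fin (suc m)) (mo : Mono n) →
    ∑ (subsets (suc m) (suc k)) (λ T → + weight C T *ℤ coeff (cofactorTerm ρ (lowerCells T C) j) mo)
      ≡ coeff (xy (ρ zero) (C j) *P loweringSum (ρ ∘ suc) (C ∘ punchIn j) (suc k)) mo
        +ℤ + proj₁ (C j) *ℤ coeff (xy (ρ zero) (lowerCell (C j)) *P loweringSum (ρ ∘ suc) (C ∘ punchIn j) k) mo
  ∑-column {m} ρ C k j mo = begin
    ∑ (subsets (suc m) (suc k)) F
      ≡⟨ ∑-subsets-insertAt m j (suc k) F ⟩
    ∑ (subsets m (suc k)) (λ T → F (insertAt T j false)) +ℤ ∑ (subsets m k) (λ T → F (insertAt T j true))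
      ≡⟨ cong₂ _+ℤ_ (∑-cong (subsets m (suc k)) without-j)
                    (trans (∑-cong (subsets m k) with-j) (∑-*ˡ pⱼ (subsets m k) _)) ⟩
    ∑ (subsets m (suc k)) (λ T → + weight C′ T *ℤ coeff (xy v (C j) *P Δ′ T) mo)
      +ℤ pⱼ *ℤ ∑ (subsets m k) (λ T → + weight C′ T *ℤ coeff (xy v (lowerCell (C j)) *P Δ′ T) mo)
      ≡⟨ cong₂ (λ a b → a +ℤ pⱼ *ℤ b) (coeff-*P-loweringSum (xy v (C j)) (ρ ∘ suc) C′ (suc k) mo)
                                       (coeff-*P-loweringSum (xy v (lowerCell (C j))) (ρ ∘ suc) C′ k mo) ⟨
    coeff (xy v (C j) *P loweringSum (ρ ∘ suc) C′ (suc k)) mo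
      +ℤ pⱼ *ℤ coeff (xy v (lowerCell (C j)) *P loweringSum (ρ ∘ suc) C′ k) mo ∎
    where
    open ≡-Reasoning
    v = ρ zero
    C′ = C ∘ punchIn j
    pⱼ = + proj₁ (C j)
    Δ′ = λ T → Δ⟨ ρ ∘ suc ⟩ (lowerCells T C′)
    F : Subset (suc m) → ℤ
    F T = + weight C T *ℤ coeff (cofactorTerm ρ (lowerCells T C) j) mo
    without-j : ∀ T → F (insertAt T j false) ≡ + weight C′ T *ℤ coeff (xy v (C j) *P Δ′ T) mo
    without-j T = cong₂ (λ w p → + w *ℤ coeff p mo)
      (trans (weight-insertAt C j false T) (ℕP.*-identityˡ _)) (cofactorTerm-insertAt ρ C j false T)
    with-j : ∀ T → F (insertAt T j true) ≡ pⱼ *ℤ (+ weight C′ T *ℤ coeff (xy v (lowerCell (C j)) *P Δ′ T) mo)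
    with-j T = begin
      + weight C (insertAt T j true) *ℤ coeff (cofactorTerm ρ (lowerCells (insertAt T j true) C) j) mo
        ≡⟨ cong₂ (λ w p → + w *ℤ coeff p mo) (weight-insertAt C j true T) (cofactorTerm-insertAt ρ C j true T) ⟩
      + (proj₁ (C j) ℕ.* weight C′ T) *ℤ coeff lowered mo
        ≡⟨ cong (_*ℤ coeff lowered mo) (ℤP.pos-* (proj₁ (C j)) (weight C′ T)) ⟩
      pⱼ *ℤ + weight C′ T *ℤ coeff lowered mo
        ≡⟨ ℤP.*-assoc pⱼ (+ weight C′ T) (coeff lowered mo) ⟩
      pⱼ *ℤ (+ weight C′ T *ℤ coeff lowered mo) ∎
      where lowered = xy v (lowerCell (C j)) *P Δ′ T

  loweringSum-expand : ∀ {m} (ρ : Fin (suc m) → Fin n) (C : Fin (suc m) → Cell) (k : ℕ) →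
                       loweringSum ρ C (suc k) ≋ rowExpansion ρ C k
  loweringSum-expand {m} ρ C k = coeffwise expand
    where
    Ts = subsets (suc m) (suc k)
    Js = allFin (suc m)
    expand : ∀ mo → coeff (loweringSum ρ C (suc k)) mo ≡ coeff (rowExpansion ρ C k) mo
    expand mo = begin
      coeff (loweringSum ρ C (suc k)) mo
        ≡⟨ trans (coeff-sumP (λ T → scaleP (w T) (Δ⟨ ρ ⟩ (lowerCells T C))) Ts mo)
                 (∑-cong Ts λ T → coeff-scaleP (w T) (Δ⟨ ρ ⟩ (lowerCells T C)) mo) ⟩
      ∑ Ts (λ T → w T *ℤ coeff (Δ⟨ ρ ⟩ (lowerCells T C)) mo)
        ≡⟨ ∑-cong Ts (λ T → trans (cong (w T *ℤ_) (coeff-Δ ρ (lowerCells T C) mo)) (sym (∑-*ˡ (w T) Js _))) ⟩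
      ∑ Ts (λ T → ∑ Js (λ j → w T *ℤ (sign (toℕ j) *ℤ c T j)))
        ≡⟨ ∑-comm Ts Js _ ⟩
      ∑ Js (λ j → ∑ Ts (λ T → w T *ℤ (sign (toℕ j) *ℤ c T j)))
        ≡⟨ ∑-cong Js (λ j → trans (∑-cong Ts (λ T → ℤ*.x∙yz≈y∙xz (w T) (sign (toℕ j)) (c T j)))
                                  (∑-*ˡ (sign (toℕ j)) Ts _)) ⟩
      ∑ Js (λ j → sign (toℕ j) *ℤ ∑ Ts (λ T → w T *ℤ c T j))
        ≡⟨ ∑-cong Js (λ j → cong (sign (toℕ j) *ℤ_) (trans (∑-column ρ C k j mo) (sym (coeff-rowTerm j)))) ⟩
      ∑ Js (λ j → sign (toℕ j) *ℤ coeff (rowTerm ρ C k j) mo)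
        ≡⟨ trans (coeff-sumP (λ j → negPow (toℕ j) (rowTerm ρ C k j)) Js mo)
                 (∑-cong Js λ j → coeff-negPow (toℕ j) (rowTerm ρ C k j) mo) ⟨
      coeff (rowExpansion ρ C k) mo ∎
      where
      open ≡-Reasoning
      w : Subset (suc m) → ℤ
      w T = + weight C T
      c : Subset (suc m) → Fin (suc m) → ℤ
      c T j = coeff (cofactorTerm ρ (lowerCells T C) j) mo
      coeff-rowTerm : ∀ j → coeff (rowTerm ρ C k j) mo
        ≡ coeff (xy (ρ zero) (C j) *P loweringSum (ρ ∘ suc) (C ∘ punchIn j) (suc k)) mo
          +ℤ + proj₁ (C j) *ℤ coeff (xy (ρ zero) (lowerCell (C j)) *P loweringSum (ρ ∘ suc) (C ∘ punchIn j) k) mo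
      coeff-rowTerm j =
        trans (coeff-++ kept (scaleP pⱼ lowered) mo) (cong (coeff kept mo +ℤ_) (coeff-scaleP pⱼ lowered mo))
        where
        pⱼ = + proj₁ (C j)
        kept = xy (ρ zero) (C j) *P loweringSum (ρ ∘ suc) (C ∘ punchIn j) (suc k)
        lowered = xy (ρ zero) (lowerCell (C j)) *P loweringSum (ρ ∘ suc) (C ∘ punchIn j) k

  e∂-Δ : ∀ {m} (ρ : Fin m → Fin n) → Injective _≡_ _≡_ ρ → (C : Fin m → Cell) (k : ℕ) →
         e∂ ρ k (Δ⟨ ρ ⟩ C) ≋ loweringSum ρ C k
  e∂-Δ ρ ρ-inj C zero = ≋-sym (loweringSum-zero ρ C)
  e∂-Δ {zero} ρ ρ-inj C (suc k) = ≋-refl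
  e∂-Δ {suc m} ρ ρ-inj C (suc k) = ≋-trans
    (e∂-Δ-step ρ C k (λ i ρ₀≡ρᵢ → FinP.0≢1+n (ρ-inj ρ₀≡ρᵢ)) (e∂-Δ (ρ ∘ suc) (FinP.suc-injective ∘ ρ-inj)))
    (≋-sym (loweringSum-expand ρ C k))

<pl-irrefl : (c : Cell) → ¬ (c <pl c)
<pl-irrefl c (inj₁ q<q) = ℕP.<-irrefl refl q<q
<pl-irrefl c (inj₂ (_ , p<p)) = ℕP.<-irrefl refl p<p

<pl-lowered : (p q : ℕ) → ¬ ((suc p , q) <pl (p , q))
<pl-lowered p q (inj₁ q<q) = ℕP.<-irrefl refl q<q
<pl-lowered p q (inj₂ (_ , p+1<p)) = ℕP.<-asym p+1<p (ℕP.n<1+n p)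

<pl-between-lowered : (p q : ℕ) (c : Cell) → (p , q) <pl c → c <pl (suc p , q) → ⊥
<pl-between-lowered p q c (inj₁ q<q′) (inj₁ q′<q) = ℕP.<-asym q<q′ q′<q
<pl-between-lowered p q c (inj₁ q<q′) (inj₂ (q′≡q , _)) = ℕP.<-irrefl (sym q′≡q) q<q′
<pl-between-lowered p q c (inj₂ (q≡q′ , _)) (inj₁ q′<q) = ℕP.<-irrefl (sym q≡q′) q′<q
<pl-between-lowered p q c (inj₂ (_ , p<p′)) (inj₂ (_ , p′<p+1)) = ℕP.<⇒≱ p<p′ (ℕP.≤-pred p′<p+1)

lowerCell-injective : {c d : Cell} → 1 ≤ proj₁ c → 1 ≤ proj₁ d → lowerCell c ≡ lowerCell d → c ≡ d
lowerCell-injective {suc p , q} {suc p′ , q′} _ _ refl = refl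

module Increasing {n : ℕ} {L : Fin n → Cell} (increasing : StrictlyIncreasing L) where

  injective : Injective _≡_ _≡_ L
  injective {i} {j} Lᵢ≡Lⱼ with ℕP.<-cmp (toℕ i) (toℕ j)
  ... | tri< i<j _ _ = ⊥-elim (<pl-irrefl (L j) (subst (_<pl L j) Lᵢ≡Lⱼ (increasing i j i<j)))
  ... | tri≈ _ i≡j _ = FinP.toℕ-injective i≡j
  ... | tri> _ _ j<i = ⊥-elim (<pl-irrefl (L j) (subst (L j <pl_) Lᵢ≡Lⱼ (increasing j i j<i)))

  -- Nothing lies strictly between (p - 1, q) and (p, q) in pseudo-lexicographic order.
  lowered-predecessor : (x y : Fin n) → 1 ≤ proj₁ (L x) → lowerCell (L x) ≡ L y → toℕ x ≡ suc (toℕ y)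
  lowered-predecessor x y 1≤pₓ lowered with L x in Lₓ≡ | 1≤pₓ
  ... | suc p , q | _ with ℕP.<-cmp (toℕ y) (toℕ x)
  ...   | tri> _ _ x<y = ⊥-elim (<pl-lowered p q (subst₂ _<pl_ Lₓ≡ (sym lowered) (increasing x y x<y)))
  ...   | tri≈ _ y≡x _ =
    ⊥-elim (ℕP.1+n≢n (sym (cong proj₁ (trans lowered (trans (cong L (FinP.toℕ-injective y≡x)) Lₓ≡)))))
  ...   | tri< y<x _ _ with ℕP.m≤n⇒m<n∨m≡n y<x
  ...     | inj₂ y+1≡x = sym y+1≡x
  ...     | inj₁ y+1<x = ⊥-elim (<pl-between-lowered p q (L l)
      (subst (_<pl L l) (sym lowered) (increasing y l (ℕP.≤-reflexive (sym toℕl≡y+1))))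
      (subst (L l <pl_) Lₓ≡ (increasing l x (subst (ℕ._< toℕ x) (sym toℕl≡y+1) y+1<x))))
    where
    l : Fin n
    l = Fin.fromℕ< (ℕP.<-trans y+1<x (FinP.toℕ<n x))
    toℕl≡y+1 : toℕ l ≡ suc (toℕ y)
    toℕl≡y+1 = FinP.toℕ-fromℕ< (ℕP.<-trans y+1<x (FinP.toℕ<n x))

  Collision : Subset n → Set
  Collision S = ∃ λ i → ∃ λ j → i ≢ j × lowerCells S L i ≡ lowerCells S L j

  collision? : (S : Subset n) → Dec (Collision S)
  collision? S = FinP.any? λ i → FinP.any? λ j → ¬? (i Fin.≟ j) ×-dec (lowerCells S L i ≟Cell lowerCells S L j)
    where _≟Cell_ = ProdP.≡-dec ℕ._≟_ ℕ._≟_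

  lowerCells-∈ : (S : Subset n) (j : Fin n) → lookup S j ≡ true → lowerCells S L j ≡ lowerCell (L j)
  lowerCells-∈ S j Sⱼ rewrite Sⱼ = refl

  lowerCells-∉ : (S : Subset n) (j : Fin n) → lookup S j ≡ false → lowerCells S L j ≡ L j
  lowerCells-∉ S j Sⱼ rewrite Sⱼ = refl

  collision⇒Δ≋0 : (S : Subset n) → (∀ j → lookup S j ≡ true → 1 ≤ proj₁ (L j)) → Collision S →
                  Δ (lowerCells S L) ≋ 0P
  collision⇒Δ≋0 S positive (i , j , i≢j , same) with lookup S i in Sᵢ | lookup S j in Sⱼ
  ... | false | false = ⊥-elim (i≢j (injective same))
  ... | true  | true  = ⊥-elim (i≢j (injective (lowerCell-injective (positive i Sᵢ) (positive j Sⱼ) same)))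
  ... | true  | false = Δ-alternating-toℕ id (lowerCells S L) j i
    (lowered-predecessor i j (positive i Sᵢ) same)
    (trans (lowerCells-∉ S j Sⱼ) (trans (sym same) (sym (lowerCells-∈ S i Sᵢ))))
  ... | false | true  = Δ-alternating-toℕ id (lowerCells S L) i j
    (lowered-predecessor j i (positive j Sⱼ) (sym same))
    (trans (lowerCells-∉ S i Sᵢ) (trans same (sym (lowerCells-∈ S j Sⱼ))))

  ε : Subset n → ℕ
  ε S = if does (collision? S) then 0 else weight L S

  ε≢0⇒valid : (S : Subset n) → ε S ≢ 0 → ValidLowering S L
  ε≢0⇒valid S ε≢0 with collision? S
  ... | yes _ = ⊥-elim (ε≢0 refl)
  ... | no no-collision =
    (λ j j∈S → weight≢0⇒positive L S j ε≢0 (VecP.[]=⇒lookup j∈S)) ,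
    (λ i j same → decidable-stable (i Fin.≟ j) (λ i≢j → no-collision (i , j , i≢j , same)))

  weight≋ε : (S : Subset n) → scaleP (+ weight L S) (Δ (lowerCells S L)) ≋ scaleP (+ ε S) (Δ (lowerCells S L))
  weight≋ε S with collision? S | weight L S ℕ.≟ 0
  ... | no _  | _       = ≋-refl
  ... | yes _ | yes w≡0 = ≡⇒≋ (cong (λ w → scaleP (+ w) (Δ (lowerCells S L))) w≡0)
  ... | yes c | no w≢0  = ≋-trans
    (scaleP-cong (+ weight L S) (collision⇒Δ≋0 S (λ j → weight≢0⇒positive L S j w≢0) c))
    (≋-sym (scaleP-zero (Δ (lowerCells S L))))

mainTheorem1 : (n : ℕ) (L : Fin n → Cell) → StrictlyIncreasing L →
    (k : ℕ) → 1 ≤ k →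
    ∃ λ (ε : Subset n → ℕ) →
      (∀ S → ε S ≢ 0 → ValidLowering S L) ×
      (eOp k (Δ L) ≈P sumP (map (λ S → scaleP (+ ε S) (Δ (lowerCells S L))) (kSubsets n k)))
mainTheorem1 n L increasing k _ = ε , ε≢0⇒valid , coeff-≡ (begin
  eOp k (Δ L)                                   ≈⟨ eOp≋e∂ k (Δ L) ⟩
  e∂ id k (Δ L)                                 ≈⟨ e∂-Δ id (λ eq → eq) L k ⟩
  loweringSum id L k                            ≈⟨ sumP-cong (subsets n k) weight≋ε ⟩
  sumP (map εΔ (subsets n k))                   ≡⟨ cong (sumP ∘ map εΔ) (kSubsets≡subsets n k) ⟨
  sumP (map εΔ (kSubsets n k))                  ∎)
  where
  open Increasing increasing
  open ≋-Reasoning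
  εΔ = λ S → scaleP (+ ε S) (Δ (lowerCells S L))
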